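{- Let $r\geq1$ and let $G_0$ and $G_1$ be two graphs on the same vertex set $V$ with $|V|=n$ such that for every $E'\subseteq E(G_1)$ with $|E'|\leq n$ there exists a vertex $v\in V$ satisfying $|N_{G_1}(v)\cap B_{G_0\cup E'}(v)|>r$. Then for every subgraph $H\subseteq G_1$ of maximum degree $\Delta(H)\leq r$, the graph $G_0+(G_1-H)$ is Hamiltonian.
   Context: For a graph $G$, $\ell(G)$ denotes the length of a longest path in $G$. A non-edge $\{u,v\}\notin E(G)$ is a booster with respect to $G$ if $G+\{u,v\}$ is Hamiltonian or $\ell(G+\{u,v\})>\ell(G)$. For a vertex $v$, $B_G(v)=\{w\notin N_G(v)\cup\{v\}: \{v,w\}\text{ is a booster w.r.t. } G\}$. $N_G(v)$ is the neighborhood of $v$. $G_0\cup E'$ is $G_0$ with the edges of $E'$ added; $G_1-H$ is $G_1$ with the edges of $H$ deleted; $G_0+(G_1-H)$ is the union of the two graphs on $V$. -}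

module Defs where

open import Data.Nat using (ℕ; zero; suc; _≤_; _<_; _<ᵇ_)
open import Data.Fin using (Fin; toℕ; _≟_)
open import Data.Fin.Subset using (Subset; _∈_; ∣_∣)
open import Data.Bool using (Bool; true; false; _∧_; _∨_; not)
open import Data.Vec using (tabulate; sum)
open import Data.Product using (Σ; Σ-syntax; ∃; ∃-syntax; _×_)
open import Data.Sum using (_⊎_)
open import Relation.Binary.PropositionalEquality using (_≡_; _≢_)
open import Relation.Nullary.Decidable using (⌊_⌋)
open import Function.Definitions using (Injective)

Graph : ℕ → Set
Graph n = Fin n → Fin n → Bool

record IsGraph {n : ℕ} (G : Graph n) : Set where
  field
    sym     : ∀ u v → G u v ≡ G v u
    irrefl  : ∀ v → G v v ≡ false

N : ∀ {n} → Graph n → Fin n → Subset n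
N G v = tabulate (G v)

deg : ∀ {n} → Graph n → Fin n → ℕ
deg G v = ∣ N G v ∣

numEdges : ∀ {n} → Graph n → ℕ
numEdges G = sum (tabulate (λ u → ∣ tabulate (λ v → (toℕ u <ᵇ toℕ v) ∧ G u v) ∣))

_⊆G_ : ∀ {n} → Graph n → Graph n → Set
H ⊆G G = ∀ u v → H u v ≡ true → G u v ≡ true

_∪G_ : ∀ {n} → Graph n → Graph n → Graph n
(G ∪G F) u v = G u v ∨ F u v

_−G_ : ∀ {n} → Graph n → Graph n → Graph n
(G −G H) u v = G u v ∧ not (H u v)

addEdge : ∀ {n} → Graph n → Fin n → Fin n → Graph n
addEdge G a b u v = G u v ∨ ((⌊ u ≟ a ⌋ ∧ ⌊ v ≟ b ⌋) ∨ (⌊ u ≟ b ⌋ ∧ ⌊ v ≟ a ⌋))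

-- G has a path with k edges (k+1 distinct vertices, consecutive ones adjacent).
HasPath : ∀ {n} → Graph n → ℕ → Set
HasPath {n} G k =
  Σ[ p ∈ (Fin (suc k) → Fin n) ] Injective _≡_ _≡_ p ×
    (∀ i j → suc (toℕ i) ≡ toℕ j → G (p i) (p j) ≡ true)

-- ℓ(G') > ℓ(G): G' has a path longer than every path of G.
LongerPaths : ∀ {n} → Graph n → Graph n → Set
LongerPaths G' G = ∃[ k ] HasPath G' k × (∀ m → HasPath G m → m < k)

Hamiltonian : ∀ {n} → Graph n → Set
Hamiltonian {n} G =
  3 ≤ n × (Σ[ p ∈ (Fin n → Fin n) ] Injective _≡_ _≡_ p ×
    (∀ i j → (suc (toℕ i) ≡ toℕ j ⊎ (suc (toℕ i) ≡ n × toℕ j ≡ 0)) →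
       G (p i) (p j) ≡ true))

Booster : ∀ {n} → Graph n → Fin n → Fin n → Set
Booster G u v = u ≢ v × G u v ≡ false ×
  (Hamiltonian (addEdge G u v) ⊎ LongerPaths (addEdge G u v) G)

InB : ∀ {n} → Graph n → Fin n → Fin n → Set
InB G v w = Booster G v w

-- |N_{G₁}(v) ∩ B_G(v)| > r : there is a set of more than r vertices inside N_{G₁}(v) ∩ B_G(v).
-- (B_G(v) is a Set-valued predicate, so its size is expressed via a subset of it.)
BigIntersection : ∀ {n} → ℕ → Graph n → Graph n → Fin n → Set
BigIntersection {n} r G₁ G v =
  Σ[ S ∈ Subset n ] (∀ w → w ∈ S → (w ∈ N G₁ v × InB G v w)) × r < ∣ S ∣

-- Grow a set E ⊆ G₁ − H of added edges while keeping a path with k edges in G₀ ∪ E and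
-- |E| ≤ k (so |E| < n). The hypothesis applied to E yields a vertex v with more than r
-- boosters among its G₁-neighbours; at most r of them are H-neighbours, so some booster vw
-- is an edge of G₁ − H. Adding it either makes G₀ ∪ E Hamiltonian, hence G₀ + (G₁ − H),
-- or lengthens the longest path: k grows by at least one while |E| grows by at most one.
-- As paths have fewer than n edges, this must end with a Hamiltonian cycle.
module Submission where

open import Defs
open import Data.Nat using (ℕ; zero; suc; _+_; _≤_; _<_; _<ᵇ_; z≤n; s≤s)
open import Data.Nat.Properties
  using (≤-trans; ≤-reflexive; <⇒≤; <⇒≱; <-asym; _<?_; <ᵇ⇒<;
         +-mono-≤; +-monoʳ-≤; +-suc; +-comm; +-identityʳ; +-commutativeSemigroup)
open import Algebra.Properties.CommutativeSemigroup +-commutativeSemigroup using (interchange)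
open import Data.Bool using (Bool; true; false; T; _∧_; _∨_; not)
open import Data.Bool.Properties using (∨-assoc; ∨-comm; ∧-comm; ∧-zeroʳ; ∧-distribˡ-∨)
open import Data.Empty using (⊥-elim)
open import Data.Unit using (tt)
open import Data.Fin using (Fin; zero; suc; toℕ; _≟_)
open import Data.Fin.Properties using (suc-injective; injective⇒≤; ¬∀⟶∃¬)
open import Data.Fin.Subset using (Subset; inside; outside; _∈_; _∉_; _⊆_; _∪_; ⁅_⁆; ∣_∣; Empty)
open import Data.Fin.Subset.Properties
  using (_∈?_; p⊆q⇒∣p∣≤∣q∣; ∣p∣≤∣x∷p∣; ∣⊥∣≡0; Empty-unique; x∈⁅x⁆; ∣⁅x⁆∣≡1; x∈p∪q⁺)
open import Data.Vec using ([]; _∷_; tabulate; sum)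
open import Data.Vec.Properties using (lookup∘tabulate; []=⇒lookup; lookup⇒[]=)
open import Data.Product using (∃-syntax; _×_; _,_; proj₁; proj₂)
import Data.Product as Product
open import Data.Sum using (_⊎_; inj₁; inj₂)
import Data.Sum as Sum
open import Function using (_∘_)
open import Relation.Binary.PropositionalEquality
open import Relation.Nullary using (¬_; yes; no)
open import Relation.Nullary.Decidable using (⌊_⌋; _→-dec_; decidable-stable)

∧-true⁻ : ∀ a b → a ∧ b ≡ true → a ≡ true × b ≡ true
∧-true⁻ true true _ = refl , refl

∧-not-true⁺ : ∀ {a b} → a ≡ true → ¬ b ≡ true → a ∧ not b ≡ true
∧-not-true⁺ {b = false} refl _  = refl
∧-not-true⁺ {b = true}  _    ¬b = ⊥-elim (¬b refl)

∨-true⁻ : ∀ a b → a ∨ b ≡ true → a ≡ true ⊎ b ≡ true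
∨-true⁻ true  _ _ = inj₁ refl
∨-true⁻ false _ e = inj₂ e

∨-true⁺ˡ : ∀ {a} b → a ≡ true → a ∨ b ≡ true
∨-true⁺ˡ _ refl = refl

∨-true⁺ʳ : ∀ a {b} → b ≡ true → a ∨ b ≡ true
∨-true⁺ʳ true  _ = refl
∨-true⁺ʳ false e = e

≟-true⁻ : ∀ {n} {x y : Fin n} → ⌊ x ≟ y ⌋ ≡ true → x ≡ y
≟-true⁻ {x = x} {y} e with x ≟ y
... | yes x≡y = x≡y

<ᵇ-true⁻ : ∀ {m n} → (m <ᵇ n) ≡ true → m < n
<ᵇ-true⁻ {m} {n} e = <ᵇ⇒< m n (subst T (sym e) tt)

∈-tabulate⁺ : ∀ {n} {f : Fin n → Bool} {x} → f x ≡ true → x ∈ tabulate f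
∈-tabulate⁺ {f = f} {x} fx = lookup⇒[]= x (tabulate f) (trans (lookup∘tabulate f x) fx)

∈-tabulate⁻ : ∀ {n} {f : Fin n → Bool} {x} → x ∈ tabulate f → f x ≡ true
∈-tabulate⁻ {f = f} {x} x∈ = trans (sym (lookup∘tabulate f x)) ([]=⇒lookup x∈)

Empty⇒∣p∣≡0 : ∀ {n} {p : Subset n} → Empty p → ∣ p ∣ ≡ 0
Empty⇒∣p∣≡0 {n} e = trans (cong ∣_∣ (Empty-unique e)) (∣⊥∣≡0 n)

∣p∪q∣≤∣p∣+∣q∣ : ∀ {n} (p q : Subset n) → ∣ p ∪ q ∣ ≤ ∣ p ∣ + ∣ q ∣
∣p∪q∣≤∣p∣+∣q∣ []            []            = z≤n
∣p∪q∣≤∣p∣+∣q∣ (inside  ∷ p) (s       ∷ q) =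
  s≤s (≤-trans (∣p∪q∣≤∣p∣+∣q∣ p q) (+-monoʳ-≤ ∣ p ∣ (∣p∣≤∣x∷p∣ s q)))
∣p∪q∣≤∣p∣+∣q∣ (outside ∷ p) (outside ∷ q) = ∣p∪q∣≤∣p∣+∣q∣ p q
∣p∪q∣≤∣p∣+∣q∣ (outside ∷ p) (inside  ∷ q) =
  ≤-trans (s≤s (∣p∪q∣≤∣p∣+∣q∣ p q)) (≤-reflexive (sym (+-suc ∣ p ∣ ∣ q ∣)))

∣p∣<∣q∣⇒∃∈q∉p : ∀ {n} {p q : Subset n} → ∣ p ∣ < ∣ q ∣ → ∃[ x ] x ∈ q × x ∉ p
∣p∣<∣q∣⇒∃∈q∉p {n} {p} {q} ∣p∣<∣q∣
  with ¬∀⟶∃¬ n (λ x → x ∈ q → x ∈ p) (λ x → x ∈? q →-dec x ∈? p)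
              (λ q⊆p → <⇒≱ ∣p∣<∣q∣ (p⊆q⇒∣p∣≤∣q∣ (q⊆p _)))
... | x , q⊈p = x , decidable-stable (x ∈? q) (λ x∉q → q⊈p (⊥-elim ∘ x∉q)) , q⊈p ∘ λ x∈p _ → x∈p

sum-tabulate-≤ : ∀ {n} {f g h : Fin n → ℕ} → (∀ x → f x ≤ g x + h x) →
  sum (tabulate f) ≤ sum (tabulate g) + sum (tabulate h)
sum-tabulate-≤ {zero}  _     = z≤n
sum-tabulate-≤ {suc n} {g = g} {h} f≤g+h =
  ≤-trans (+-mono-≤ (f≤g+h zero) (sum-tabulate-≤ (f≤g+h ∘ suc)))
          (≤-reflexive (interchange (g zero) (h zero) _ _))

sum-tabulate-≡0 : ∀ {n} {f : Fin n → ℕ} → (∀ x → f x ≡ 0) → sum (tabulate f) ≡ 0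
sum-tabulate-≡0 {zero}  _   = refl
sum-tabulate-≡0 {suc n} f≡0 = cong₂ _+_ (f≡0 zero) (sum-tabulate-≡0 (f≡0 ∘ suc))

sum-tabulate-single : ∀ {n} (m : Fin n) {f : Fin n → ℕ} → (∀ x → x ≢ m → f x ≡ 0) →
  sum (tabulate f) ≡ f m
sum-tabulate-single zero    {f} off =
  trans (cong (f zero +_) (sum-tabulate-≡0 (λ x → off (suc x) λ ()))) (+-identityʳ (f zero))
sum-tabulate-single (suc m) {f} off =
  cong₂ _+_ (off zero λ ()) (sum-tabulate-single m (λ x x≢m → off (suc x) (x≢m ∘ suc-injective)))

forwardN : ∀ {n} → Graph n → Fin n → Subset n
forwardN G u = tabulate (λ v → (toℕ u <ᵇ toℕ v) ∧ G u v)

numEdges-∪G : ∀ {n} (G F : Graph n) → numEdges (G ∪G F) ≤ numEdges G + numEdges F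
numEdges-∪G G F = sum-tabulate-≤ λ u →
  ≤-trans (p⊆q⇒∣p∣≤∣q∣ (forwardN-∪G u)) (∣p∪q∣≤∣p∣+∣q∣ (forwardN G u) (forwardN F u))
  where
  forwardN-∪G : ∀ u → forwardN (G ∪G F) u ⊆ forwardN G u ∪ forwardN F u
  forwardN-∪G u {v} v∈ = x∈p∪q⁺ (Sum.map ∈-tabulate⁺ ∈-tabulate⁺
    (∨-true⁻ (u<v ∧ G u v) (u<v ∧ F u v)
      (trans (sym (∧-distribˡ-∨ u<v (G u v) (F u v))) (∈-tabulate⁻ v∈))))
    where
    u<v = toℕ u <ᵇ toℕ v

numEdges≤1 : ∀ {n} {G : Graph n} (m M : Fin n) →
  (∀ u v → (toℕ u <ᵇ toℕ v) ∧ G u v ≡ true → u ≡ m × v ≡ M) → numEdges G ≤ 1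
numEdges≤1 {G = G} m M only = begin
  numEdges G         ≡⟨ sum-tabulate-single m forwardN≡∅ ⟩
  ∣ forwardN G m ∣   ≤⟨ p⊆q⇒∣p∣≤∣q∣ forwardN⊆⁅M⁆ ⟩
  ∣ ⁅ M ⁆ ∣          ≡⟨ ∣⁅x⁆∣≡1 M ⟩
  1                  ∎
  where
  open Data.Nat.Properties.≤-Reasoning
  forwardN≡∅ : ∀ u → u ≢ m → ∣ forwardN G u ∣ ≡ 0
  forwardN≡∅ u u≢m = Empty⇒∣p∣≡0 {p = forwardN G u}
    λ (v , v∈) → u≢m (proj₁ (only u v (∈-tabulate⁻ v∈)))
  forwardN⊆⁅M⁆ : forwardN G m ⊆ ⁅ M ⁆
  forwardN⊆⁅M⁆ {v} v∈ = subst (_∈ ⁅ M ⁆) (sym (proj₂ (only m v (∈-tabulate⁻ v∈)))) (x∈⁅x⁆ M)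

edge : ∀ {n} → Fin n → Fin n → Graph n
edge a b u v = (⌊ u ≟ a ⌋ ∧ ⌊ v ≟ b ⌋) ∨ (⌊ u ≟ b ⌋ ∧ ⌊ v ≟ a ⌋)

edge-true⁻ : ∀ {n} (a b u v : Fin n) → edge a b u v ≡ true → (u ≡ a × v ≡ b) ⊎ (u ≡ b × v ≡ a)
edge-true⁻ a b u v e =
  Sum.map endpoints endpoints (∨-true⁻ (⌊ u ≟ a ⌋ ∧ ⌊ v ≟ b ⌋) (⌊ u ≟ b ⌋ ∧ ⌊ v ≟ a ⌋) e)
  where
  endpoints : ∀ {x y z w} → ⌊ x ≟ y ⌋ ∧ ⌊ z ≟ w ⌋ ≡ true → x ≡ y × z ≡ w
  endpoints {x} {y} {z} {w} = Product.map ≟-true⁻ ≟-true⁻ ∘ ∧-true⁻ ⌊ x ≟ y ⌋ ⌊ z ≟ w ⌋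

edge-sym : ∀ {n} (a b u v : Fin n) → edge a b u v ≡ edge a b v u
edge-sym a b u v = trans (cong₂ _∨_ (∧-comm ⌊ u ≟ a ⌋ ⌊ v ≟ b ⌋) (∧-comm ⌊ u ≟ b ⌋ ⌊ v ≟ a ⌋))
  (∨-comm (⌊ v ≟ b ⌋ ∧ ⌊ u ≟ a ⌋) (⌊ v ≟ a ⌋ ∧ ⌊ u ≟ b ⌋))

edge-irrefl : ∀ {n} {a b : Fin n} → a ≢ b → ∀ u → edge a b u u ≡ false
edge-irrefl {a = a} {b} a≢b u with u ≟ a | u ≟ b
... | yes refl | yes refl = ⊥-elim (a≢b refl)
... | yes _    | no _     = refl
... | no _     | yes _    = refl
... | no _     | no _     = refl

forward-edge⁻ : ∀ {n} (a b u v : Fin n) → (toℕ u <ᵇ toℕ v) ∧ edge a b u v ≡ true →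
  (u ≡ a × v ≡ b × toℕ a < toℕ b) ⊎ (u ≡ b × v ≡ a × toℕ b < toℕ a)
forward-edge⁻ a b u v e with ∧-true⁻ (toℕ u <ᵇ toℕ v) (edge a b u v) e
... | u<v , uv with edge-true⁻ a b u v uv
...   | inj₁ (refl , refl) = inj₁ (refl , refl , <ᵇ-true⁻ u<v)
...   | inj₂ (refl , refl) = inj₂ (refl , refl , <ᵇ-true⁻ u<v)

numEdges-edge : ∀ {n} (a b : Fin n) → numEdges (edge a b) ≤ 1
numEdges-edge a b with toℕ b <? toℕ a
... | yes b<a = numEdges≤1 b a λ u v e →
  Sum.[ (λ (_ , _ , a<b) → ⊥-elim (<-asym a<b b<a)) , Product.map₂ proj₁ ] (forward-edge⁻ a b u v e)
... | no b≮a = numEdges≤1 a b λ u v e →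
  Sum.[ Product.map₂ proj₁ , (λ (_ , _ , b<a) → ⊥-elim (b≮a b<a)) ] (forward-edge⁻ a b u v e)

numEdges-addEdge : ∀ {n} (G : Graph n) (a b : Fin n) → numEdges (addEdge G a b) ≤ suc (numEdges G)
numEdges-addEdge G a b =
  ≤-trans (numEdges-∪G G (edge a b))
    (≤-trans (+-monoʳ-≤ (numEdges G) (numEdges-edge a b)) (≤-reflexive (+-comm (numEdges G) 1)))

addEdge-isGraph : ∀ {n} {G : Graph n} {a b : Fin n} → IsGraph G → a ≢ b → IsGraph (addEdge G a b)
addEdge-isGraph {a = a} {b} g a≢b = record
  { sym    = λ u v → cong₂ _∨_ (IsGraph.sym g u v) (edge-sym a b u v)
  ; irrefl = λ u → cong₂ _∨_ (IsGraph.irrefl g u) (edge-irrefl a≢b u)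
  }

−G-isGraph : ∀ {n} {G H : Graph n} → IsGraph G → IsGraph H → IsGraph (G −G H)
−G-isGraph g h = record
  { sym    = λ u v → cong₂ _∧_ (IsGraph.sym g u v) (cong not (IsGraph.sym h u v))
  ; irrefl = λ u → cong (_∧ _) (IsGraph.irrefl g u)
  }

emptyGraph : ∀ {n} → Graph n
emptyGraph _ _ = false

emptyGraph-isGraph : ∀ {n} → IsGraph (emptyGraph {n})
emptyGraph-isGraph = record { sym = λ _ _ → refl ; irrefl = λ _ → refl }

numEdges-emptyGraph : ∀ {n} → numEdges (emptyGraph {n}) ≡ 0
numEdges-emptyGraph {n} = sum-tabulate-≡0 λ u → Empty⇒∣p∣≡0 {p = forwardN (emptyGraph {n}) u}
  λ (v , v∈) → no-edge (trans (sym (∧-zeroʳ (toℕ u <ᵇ toℕ v))) (∈-tabulate⁻ v∈))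
  where
  no-edge : ¬ false ≡ true
  no-edge ()

⊆G-trans : ∀ {n} {G F K : Graph n} → G ⊆G F → F ⊆G K → G ⊆G K
⊆G-trans G⊆F F⊆K u v = F⊆K u v ∘ G⊆F u v

∪G-monoʳ : ∀ {n} (G : Graph n) {E F : Graph n} → E ⊆G F → (G ∪G E) ⊆G (G ∪G F)
∪G-monoʳ G {E} E⊆F u v e with ∨-true⁻ (G u v) (E u v) e
... | inj₁ Guv = ∨-true⁺ˡ _ Guv
... | inj₂ Euv = ∨-true⁺ʳ (G u v) (E⊆F u v Euv)

−G-⊆G : ∀ {n} {G H : Graph n} → (G −G H) ⊆G G
−G-⊆G {G = G} {H} u v = proj₁ ∘ ∧-true⁻ (G u v) (not (H u v))

addEdge-∪G : ∀ {n} (G E : Graph n) (a b : Fin n) → addEdge (G ∪G E) a b ⊆G (G ∪G addEdge E a b)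
addEdge-∪G G E a b u v e = trans (sym (∨-assoc (G u v) (E u v) (edge a b u v))) e

addEdge-⊆G : ∀ {n} {E F : Graph n} {a b : Fin n} → IsGraph F → E ⊆G F → F a b ≡ true →
  addEdge E a b ⊆G F
addEdge-⊆G {E = E} {a = a} {b} f E⊆F Fab u v e with ∨-true⁻ (E u v) (edge a b u v) e
... | inj₁ Euv = E⊆F u v Euv
... | inj₂ uv with edge-true⁻ a b u v uv
...   | inj₁ (refl , refl) = Fab
...   | inj₂ (refl , refl) = trans (IsGraph.sym f b a) Fab

Hamiltonian-mono : ∀ {n} {G G' : Graph n} → G ⊆G G' → Hamiltonian G → Hamiltonian G'
Hamiltonian-mono G⊆G' (3≤n , p , p-inj , adj) = 3≤n , p , p-inj , λ i j i→j → G⊆G' _ _ (adj i j i→j)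

HasPath-mono : ∀ {n k} {G G' : Graph n} → G ⊆G G' → HasPath G k → HasPath G' k
HasPath-mono G⊆G' (p , p-inj , adj) = p , p-inj , λ i j i→j → G⊆G' _ _ (adj i j i→j)

HasPath⇒<n : ∀ {n k} {G : Graph n} → HasPath G k → k < n
HasPath⇒<n (_ , p-inj , _) = injective⇒≤ p-inj

trivialPath : ∀ {n} {G : Graph n} → Fin n → HasPath G 0
trivialPath v = (λ _ → v) , (λ {i} {j} _ → unique i j) , λ { zero zero () }
  where
  unique : (i j : Fin 1) → i ≡ j
  unique zero zero = refl

booster-in-−G : ∀ {n r} {G₁ H G : Graph n} {v : Fin n} → deg H v ≤ r →
  BigIntersection r G₁ G v → ∃[ w ] (G₁ −G H) v w ≡ true × Booster G v w
booster-in-−G degHv≤r (S , S⊆ , r<∣S∣) with ∣p∣<∣q∣⇒∃∈q∉p (≤-trans (s≤s degHv≤r) r<∣S∣)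
... | w , w∈S , w∉NH with S⊆ w w∈S
... | w∈NG₁ , booster = w , ∧-not-true⁺ (∈-tabulate⁻ w∈NG₁) (w∉NH ∘ ∈-tabulate⁺) , booster

module Extension {n r : ℕ} (G₀ G₁ H : Graph n) (g₁ : IsGraph G₁) (h : IsGraph H)
  (Δ≤r : ∀ v → deg H v ≤ r)
  (boosted : (E' : Graph n) → IsGraph E' → E' ⊆G G₁ → numEdges E' ≤ n →
    ∃[ v ] BigIntersection r G₁ (G₀ ∪G E') v) where

  F : Graph n
  F = G₁ −G H

  F-isGraph : IsGraph F
  F-isGraph = −G-isGraph g₁ h

  record Stage (k : ℕ) : Set where
    constructor stage
    field
      E       : Graph n
      isGraph : IsGraph E
      E⊆F     : E ⊆G F
      size≤k  : numEdges E ≤ k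
      path    : HasPath (G₀ ∪G E) k

  initialStage : Fin n → Stage 0
  initialStage v = stage emptyGraph emptyGraph-isGraph (λ _ _ ())
    (≤-reflexive (numEdges-emptyGraph {n})) (trivialPath {G = G₀ ∪G emptyGraph} v)

  advance : ∀ {k} → Stage k → Hamiltonian (G₀ ∪G F) ⊎ ∃[ k' ] k < k' × Stage k'
  advance {k} (stage E e E⊆F size≤k P)
    with boosted E e (⊆G-trans E⊆F (−G-⊆G {G = G₁} {H}))
                     (≤-trans size≤k (<⇒≤ (HasPath⇒<n {G = G₀ ∪G E} P)))
  ... | v , big with booster-in-−G {G₁ = G₁} {H} (Δ≤r v) big
  ... | w , Fvw , v≢w , _ , inj₁ ham =
    inj₁ (Hamiltonian-mono (⊆G-trans (addEdge-∪G G₀ E v w) (∪G-monoʳ G₀ E'⊆F)) ham)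
    where
    E'⊆F : addEdge E v w ⊆G F
    E'⊆F = addEdge-⊆G {a = v} {w} F-isGraph E⊆F Fvw
  ... | w , Fvw , v≢w , _ , inj₂ (k' , P' , shorter) =
    inj₂ (k' , k<k' , stage (addEdge E v w) (addEdge-isGraph e v≢w)
                            (addEdge-⊆G {a = v} {w} F-isGraph E⊆F Fvw)
                            (≤-trans (numEdges-addEdge E v w) (≤-trans (s≤s size≤k) k<k'))
                            (HasPath-mono (addEdge-∪G G₀ E v w) P'))
    where
    k<k' : k < k'
    k<k' = shorter k P

  hamiltonian : ∀ slack {k} → n ≤ slack + k → Stage k → Hamiltonian (G₀ ∪G F)
  hamiltonian zero n≤k s = ⊥-elim (<⇒≱ (HasPath⇒<n {G = G₀ ∪G Stage.E s} (Stage.path s)) n≤k)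
  hamiltonian (suc slack) {k} n≤1+s+k s with advance s
  ... | inj₁ ham = ham
  ... | inj₂ (k' , k<k' , s') = hamiltonian slack (≤-trans n≤1+s+k
          (≤-trans (≤-reflexive (sym (+-suc slack k))) (+-monoʳ-≤ slack k<k'))) s'

lemma4p2 : (n r : ℕ) → 1 ≤ r → (G₀ G₁ : Graph n) → IsGraph G₀ → IsGraph G₁ →
    ((E' : Graph n) → IsGraph E' → E' ⊆G G₁ → numEdges E' ≤ n →
      ∃[ v ] BigIntersection r G₁ (G₀ ∪G E') v) →
    (H : Graph n) → IsGraph H → H ⊆G G₁ → (∀ v → deg H v ≤ r) →
    Hamiltonian (G₀ ∪G (G₁ −G H))
lemma4p2 n r _ G₀ G₁ _ g₁ boosted H h _ Δ≤r
  with boosted emptyGraph emptyGraph-isGraph (λ _ _ ())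
              (≤-trans (≤-reflexive (numEdges-emptyGraph {n})) z≤n)
... | v , _ =
  hamiltonian n (≤-reflexive (sym (+-identityʳ n))) (initialStage v)
  where open Extension G₀ G₁ H g₁ h Δ≤r boosted
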